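{- Let $m,\ell$ be integers with $1\le\ell<m$. The worst/best-score algorithm for $\ell$-truncated elections (described in the context), applied to the Minimax score, is an $r$-approximation algorithm for the Minimax rule on $\ell$-truncated instances, where $$r=\frac{1}{(m-\ell)\cdot\left(1+\frac{\ell^2}{m^2-\ell^2-m+\ell}\right)}\ \ge\ \frac{1}{m-\ell/2};$$ that is, for every election $E$ with $m$ candidates, the candidate $w$ returned on $\mathrm{trunc}(E,\ell)$ satisfies $\mathrm{sc}_{\mathrm{MM}}(w)\ge r\cdot\max_{c\in C}\mathrm{sc}_{\mathrm{MM}}(c)$.
   Context: An election $E=(V,C)$ has $n$ voters with strict linear orders $\succ_i$ over the candidate set $C$, $|C|=m$. For $c,c'\in C$, $\mathrm{sc}_{\mathrm{MM}}(c,c')=|\{v_i\in V:c\succ_i c'\}|$, and $\mathrm{sc}_{\mathrm{MM}}(c)=\min_{c'\ne c}\mathrm{sc}_{\mathrm{MM}}(c,c')$. The $\ell$-truncated instance $\mathrm{trunc}(E,\ell)$ contains, for each voter, only the ranking of her top $\ell$ candidates; a completion of it is any election in which each voter's top $\ell$ candidates are ranked as given. Algorithm: for each candidate $c$, $\mathrm{worst}(c)$ is the minimum, and $\mathrm{best}(c)$ the maximum, of $\mathrm{sc}_{\mathrm{MM}}(c)$ over all completions of the truncated instance. Let $a$ be a candidate with highest $\mathrm{worst}$, $b_1$ a candidate with highest $\mathrm{best}$, and $b_2$ a candidate with highest $\mathrm{best}$ among candidates other than $b_1$. Return $a$ if $\mathrm{worst}(a)/\mathrm{best}(b_1)\ge\mathrm{worst}(b_1)/\mathrm{best}(b_2)$,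 otherwise return $b_1$. -}

module Defs where

open import Data.Nat as ℕ using (ℕ; zero; suc; _<_; _≤_; _≤?_; _⊓_)
open import Data.Fin using (Fin; toℕ)
open import Data.Fin.Properties using (_≟_)
import Data.Fin as F
open import Data.Fin.Permutation using (Permutation′; _⟨$⟩ʳ_; _⟨$⟩ˡ_)
open import Data.List using (List; length; filter; map; foldr; allFin)
open import Data.Product using (Σ; _×_; _,_)
open import Data.Integer using (+_)
open import Data.Rational as ℚ using (ℚ; 0ℚ; 1ℚ; _/_; _+_; _*_; _-_; _÷_; ≢-nonZero)
import Data.Rational.Properties as ℚP
open import Relation.Nullary using (yes; no; ¬?)
open import Relation.Binary.PropositionalEquality using (_≡_; _≢_)

-- A ballot over m candidates: a permutation π of Fin m, where
-- π ⟨$⟩ʳ p is the candidate at position p (position 0 = top).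
Ballot : ℕ → Set
Ballot m = Permutation′ m

Election : ℕ → ℕ → Set
Election n m = Fin n → Ballot m

pos : ∀ {m} → Ballot m → Fin m → Fin m
pos π c = π ⟨$⟩ˡ c

scPair : ∀ {n m} → Election n m → Fin m → Fin m → ℕ
scPair {n} E c c' = length (filter (λ i → pos (E i) c F.<? pos (E i) c') (allFin n))

-- sc_MM(c) = min over c' ≠ c of sc_MM(c, c').
-- (Folded starting from n, which is an upper bound of every sc_MM(c,c');
--  so for m ≥ 2 this is exactly the minimum over the nonempty set c' ≠ c.)
scMM : ∀ {n m} → Election n m → Fin m → ℕ
scMM {n} {m} E c =
  foldr _⊓_ n (map (scPair E c) (filter (λ c' → ¬? (c' ≟ c)) (allFin m)))

IsCompletion : ∀ {n m} → ℕ → Election n m → Election n m → Set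
IsCompletion {n} {m} ℓ E E' =
  ∀ (i : Fin n) (p : Fin m) → toℕ p < ℓ → E' i ⟨$⟩ʳ p ≡ E i ⟨$⟩ʳ p

IsWorst : ∀ {n m} → ℕ → Election n m → Fin m → ℕ → Set
IsWorst ℓ E c w =
  (Σ _ λ E' → IsCompletion ℓ E E' × scMM E' c ≡ w)
  × (∀ E' → IsCompletion ℓ E E' → w ≤ scMM E' c)

IsBest : ∀ {n m} → ℕ → Election n m → Fin m → ℕ → Set
IsBest ℓ E c b =
  (Σ _ λ E' → IsCompletion ℓ E E' × scMM E' c ≡ b)
  × (∀ E' → IsCompletion ℓ E E' → scMM E' c ≤ b)

-- The returned candidate: a if worst(a)/best(b₁) ≥ worst(b₁)/best(b₂),
-- otherwise b₁.  The comparison of fractions is done cross-multiplied,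
-- worst(b₁)·best(b₁) ≤ worst(a)·best(b₂).
output : ∀ {m} → (worst best : Fin m → ℕ) → (a b₁ b₂ : Fin m) → Fin m
output worst best a b₁ b₂ with worst b₁ ℕ.* best b₁ ≤? worst a ℕ.* best b₂
... | yes _ = a
... | no  _ = b₁

⟦_⟧ : ℕ → ℚ
⟦ k ⟧ = (+ k) / 1

-- division in ℚ, total: p ⊘ q = p ÷ q when q ≠ 0 (and 0 otherwise;
-- the fallback is never used in the theorem since all denominators are positive)
_⊘_ : ℚ → ℚ → ℚ
p ⊘ q with q ℚP.≟ 0ℚ
... | yes _ = 0ℚ
... | no q≢0 = _÷_ p q {{≢-nonZero q≢0}}

ratio : ℕ → ℕ → ℚ
ratio m ℓ =
  1ℚ ⊘ ((⟦ m ⟧ - ⟦ ℓ ⟧) * (1ℚ + ((⟦ ℓ ⟧ * ⟦ ℓ ⟧)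
        ⊘ ((⟦ m ⟧ * ⟦ m ⟧) - (⟦ ℓ ⟧ * ⟦ ℓ ⟧) - ⟦ m ⟧ + ⟦ ℓ ⟧))))

lowerBound : ℕ → ℕ → ℚ
lowerBound m ℓ = 1ℚ ⊘ (⟦ m ⟧ - (⟦ ℓ ⟧ ⊘ ⟦ 2 ⟧))

module Submission where

-- Write K = ℓ + (m − 1) and Q = ℓ + m(m − 1); then r is exactly K / Q, and r ≥ 1/(m − ℓ/2) is the
-- inequality 2Q ≤ K(2m − ℓ).
--
-- A candidate ranked first in a truncated ballot beats everybody in every completion, and each voter
-- ranks exactly one candidate first, so n ≤ m · worst(a).  Now fix c, a completion E_B realising
-- best(c) and a completion E_W realising worst(c), which is n or sc_W(c, d) for some d ≠ c.  In the
-- latter case, a voter who does not put c in the common top ℓ of E_B has c at position ≥ ℓ there;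
-- otherwise, as the top ℓ positions agree, c ≻ d in E_W or d ≻ c in E_B.  The positions of c in E_B
-- add up to its pairwise defeats, each at most n − best(c), so
-- ℓn ≤ ℓ · worst(c) + (ℓ + m − 1)(n − best(c)).  With worst(c) ≤ worst(a) and n ≤ m · worst(a)
-- this gives K · best(b) ≤ Q · worst(a) for every candidate b.
--
-- If the algorithm returns a, then K · sc(c) ≤ K · best(c) ≤ Q · worst(a) ≤ Q · sc(a).  If it returns
-- b₁, the failed test worst(a) · best(b₂) < worst(b₁) · best(b₁) together with K · best(b₁) ≤
-- Q · worst(a) yields K · best(b₂) ≤ Q · worst(b₁), which bounds every c ≠ b₁.

open import Defs
open import Data.Nat using (ℕ; _≤_; _<_)
open import Data.Fin using (Fin)
open import Data.Product using (_×_)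
open import Relation.Binary.PropositionalEquality using (_≢_)
import Data.Rational as ℚ

open import Data.Bool using (true; false; if_then_else_)
open import Data.Fin as F using (toℕ; punchIn)
import Data.Fin.Properties as FP
open import Data.Fin.Permutation using (_⟨$⟩ʳ_; _⟨$⟩ˡ_; inverseˡ; inverseʳ)
import Data.Integer as ℤ
import Data.Integer.Properties as ℤP
open import Data.List using (List; length; filter; map; tabulate; allFin)
open import Data.List.Membership.Propositional.Properties using (∈-filter⁺; ∈-filter⁻; ∈-allFin)
open import Data.List.Properties using (foldr-preservesᵇ; foldr-preservesᵒ)
import Data.List.Relation.Unary.All as All
import Data.List.Relation.Unary.All.Properties as All
import Data.List.Relation.Unary.Any as Any
import Data.List.Relation.Unary.Any.Properties as Any
open import Data.Nat as ℕ using (zero; suc; z≤n; s≤s; _≤?_; NonZero)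
import Data.Nat.Coprimality as Coprime
import Data.Nat.Properties as ℕP
open import Algebra.Properties.Semiring.Sum ℕP.+-*-semiring
  using (sum; ∑-comm; ∑-distrib-+; *-distribˡ-sum; sum-permute; sum-remove; sum-cong-≗)
open import Data.Nat.Solver using () renaming (module +-*-Solver to ℕ-Solver)
open import Data.Product using (_,_; proj₂)
open import Data.Rational using (0ℚ; 1ℚ; toℚᵘ)
import Data.Rational.Properties as ℚP
open import Data.Rational.Solver using () renaming (module +-*-Solver to ℚ-Solver)
open import Data.Rational.Unnormalised as ℚᵘ using (ℚᵘ; mkℚᵘ; *≡*; _≃_)
import Data.Rational.Unnormalised.Properties as ℚᵘP
open import Algebra.Morphism.Definitions ℚ.ℚ ℚᵘ _≃_ using (Homomorphic₂)
open import Data.Sum using (_⊎_; inj₁; inj₂; [_,_]′)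
open import Relation.Nullary using (Dec; yes; no; does; ¬_; ¬?; contradiction)
open import Relation.Unary using (Decidable)
open import Relation.Binary.PropositionalEquality
  using (_≡_; refl; sym; trans; cong; cong₂; subst; subst₂; ≢-sym; module ≡-Reasoning)

infix 4 _≐_/_
record _≐_/_ (p : ℚ.ℚ) (a b : ℕ) : Set where
  constructor mk≐
  field
    drop-mk≐ : p ℚ.* ⟦ b ⟧ ≡ ⟦ a ⟧

module _ where
  open ℚ using (_+_; _*_; _-_)

  toℚᵘ-⟦⟧ : ∀ k → toℚᵘ ⟦ k ⟧ ≡ mkℚᵘ (ℤ.+ k) 0
  toℚᵘ-⟦⟧ k = cong toℚᵘ (ℚP.normalize-coprime (Coprime.sym (Coprime.1-coprimeTo k)))

  ⟦⟧-homo : ∀ {_∙_ : ℕ → ℕ → ℕ} {_∘_ : ℚ.ℚ → ℚ.ℚ → ℚ.ℚ} {_∘ᵘ_ : ℚᵘ → ℚᵘ → ℚᵘ} →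
    Homomorphic₂ toℚᵘ _∘_ _∘ᵘ_ →
    (∀ a b → mkℚᵘ (ℤ.+ (a ∙ b)) 0 ≃ mkℚᵘ (ℤ.+ a) 0 ∘ᵘ mkℚᵘ (ℤ.+ b) 0) →
    ∀ a b → ⟦ a ∙ b ⟧ ≡ ⟦ a ⟧ ∘ ⟦ b ⟧
  ⟦⟧-homo {_∙_} {_∘_} {_∘ᵘ_} homo base a b = ℚP.toℚᵘ-injective (begin
    toℚᵘ ⟦ a ∙ b ⟧                     ≡⟨ toℚᵘ-⟦⟧ (a ∙ b) ⟩
    mkℚᵘ (ℤ.+ (a ∙ b)) 0               ≈⟨ base a b ⟩
    mkℚᵘ (ℤ.+ a) 0 ∘ᵘ mkℚᵘ (ℤ.+ b) 0   ≡⟨ cong₂ _∘ᵘ_ (toℚᵘ-⟦⟧ a) (toℚᵘ-⟦⟧ b) ⟨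
    toℚᵘ ⟦ a ⟧ ∘ᵘ toℚᵘ ⟦ b ⟧           ≈⟨ homo ⟦ a ⟧ ⟦ b ⟧ ⟨
    toℚᵘ (⟦ a ⟧ ∘ ⟦ b ⟧)               ∎)
    where open ℚᵘP.≃-Reasoning

  ⟦⟧-+ : ∀ a b → ⟦ a ℕ.+ b ⟧ ≡ ⟦ a ⟧ + ⟦ b ⟧
  ⟦⟧-+ = ⟦⟧-homo {ℕ._+_} {_+_} {ℚᵘ._+_} ℚP.toℚᵘ-homo-+ λ a b → *≡* (cong (ℤ._* ℤ.+ 1)
    (trans (ℤP.pos-+ a b) (sym (cong₂ ℤ._+_ (ℤP.*-identityʳ (ℤ.+ a)) (ℤP.*-identityʳ (ℤ.+ b))))))

  ⟦⟧-* : ∀ a b → ⟦ a ℕ.* b ⟧ ≡ ⟦ a ⟧ * ⟦ b ⟧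
  ⟦⟧-* = ⟦⟧-homo {ℕ._*_} {_*_} {ℚᵘ._*_} ℚP.toℚᵘ-homo-* λ a b →
    *≡* (cong (ℤ._* ℤ.+ 1) (ℤP.pos-* a b))

  ⟦⟧-mono-≤ : ∀ {a b} → a ≤ b → ⟦ a ⟧ ℚ.≤ ⟦ b ⟧
  ⟦⟧-mono-≤ {a} {b} a≤b = ℚP.toℚᵘ-cancel-≤ (subst₂ ℚᵘ._≤_ (sym (toℚᵘ-⟦⟧ a)) (sym (toℚᵘ-⟦⟧ b))
    (ℚᵘ.*≤* (ℤP.*-monoʳ-≤-nonNeg (ℤ.+ 1) (ℤ.+≤+ a≤b))))

  ⟦⟧-pos : ∀ k .{{_ : NonZero k}} → ℚ.Positive ⟦ k ⟧
  ⟦⟧-pos k = ℚP.normalize-pos k 1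

  ⟦⟧≢0 : ∀ k .{{_ : NonZero k}} → ⟦ k ⟧ ≢ 0ℚ
  ⟦⟧≢0 k = ≢-sym (ℚP.<⇒≢ (ℚP.positive⁻¹ ⟦ k ⟧ {{⟦⟧-pos k}}))

  ⊘-*-cancelʳ : ∀ p {q} → q ≢ 0ℚ → (p ⊘ q) * q ≡ p
  ⊘-*-cancelʳ p {q} q≢0 with q ℚP.≟ 0ℚ
  ... | yes q≡0 = contradiction q≡0 q≢0
  ... | no q≢0 = begin
    p * ℚ.1/ q * q     ≡⟨ ℚP.*-assoc p _ q ⟩
    p * (ℚ.1/ q * q)   ≡⟨ cong (p *_) (ℚP.*-inverseˡ q) ⟩
    p * 1ℚ             ≡⟨ ℚP.*-identityʳ p ⟩
    p                  ∎
    where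
    open ≡-Reasoning
    instance
      q-nonZero : ℚ.NonZero q
      q-nonZero = ℚ.≢-nonZero q≢0

  1⊘-≐ : ∀ {q} a b .{{_ : NonZero b}} → q * ⟦ a ⟧ ≡ ⟦ b ⟧ → 1ℚ ⊘ q ≐ a / b
  1⊘-≐ {q} a b qa≡b = mk≐ (begin
    (1ℚ ⊘ q) * ⟦ b ⟧        ≡⟨ cong ((1ℚ ⊘ q) *_) qa≡b ⟨
    (1ℚ ⊘ q) * (q * ⟦ a ⟧)  ≡⟨ ℚP.*-assoc (1ℚ ⊘ q) q ⟦ a ⟧ ⟨
    (1ℚ ⊘ q) * q * ⟦ a ⟧    ≡⟨ cong (_* ⟦ a ⟧) (⊘-*-cancelʳ 1ℚ q≢0) ⟩
    1ℚ * ⟦ a ⟧              ≡⟨ ℚP.*-identityˡ ⟦ a ⟧ ⟩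
    ⟦ a ⟧                   ∎)
    where
    open ≡-Reasoning
    q≢0 : q ≢ 0ℚ
    q≢0 refl = ⟦⟧≢0 b (trans (sym qa≡b) (ℚP.*-zeroˡ ⟦ a ⟧))

  ≐-*ʳ : ∀ {p a b} d → p ≐ a / b → p ≐ a ℕ.* d / (b ℕ.* d)
  ≐-*ʳ {p} {a} {b} d (mk≐ p≐) = mk≐ (begin
    p * ⟦ b ℕ.* d ⟧       ≡⟨ cong (p *_) (⟦⟧-* b d) ⟩
    p * (⟦ b ⟧ * ⟦ d ⟧)   ≡⟨ ℚP.*-assoc p ⟦ b ⟧ ⟦ d ⟧ ⟨
    p * ⟦ b ⟧ * ⟦ d ⟧     ≡⟨ cong (_* ⟦ d ⟧) p≐ ⟩
    ⟦ a ⟧ * ⟦ d ⟧         ≡⟨ ⟦⟧-* a d ⟨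
    ⟦ a ℕ.* d ⟧           ∎)
    where open ≡-Reasoning

  ≐-≤ : ∀ {p q a c k} .{{_ : NonZero k}} → p ≐ a / k → q ≐ c / k → a ≤ c → p ℚ.≤ q
  ≐-≤ {p} {q} {a} {c} {k} (mk≐ p≐) (mk≐ q≐) a≤c = ℚP.*-cancelʳ-≤-pos ⟦ k ⟧ {{⟦⟧-pos k}} (begin
    p * ⟦ k ⟧   ≡⟨ p≐ ⟩
    ⟦ a ⟧       ≤⟨ ⟦⟧-mono-≤ a≤c ⟩
    ⟦ c ⟧       ≡⟨ q≐ ⟨
    q * ⟦ k ⟧   ∎)
    where open ℚP.≤-Reasoning

  ≐-≤-cross : ∀ {p q a b c d} .{{_ : NonZero b}} .{{_ : NonZero d}} →
    p ≐ a / b → q ≐ c / d → a ℕ.* d ≤ c ℕ.* b → p ℚ.≤ q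
  ≐-≤-cross {q = q} {b = b} {c} {d} p≐ q≐ = ≐-≤ {{ℕP.m*n≢0 b d}} (≐-*ʳ d p≐)
    (subst (λ k → q ≐ c ℕ.* b / k) (ℕP.*-comm d b) (≐-*ʳ b q≐))

  ≐-*-≤ : ∀ {p a b} .{{_ : NonZero b}} → p ≐ a / b →
    ∀ {x y} → a ℕ.* x ≤ b ℕ.* y → p * ⟦ x ⟧ ℚ.≤ ⟦ y ⟧
  ≐-*-≤ {p} {a} {b} (mk≐ p≐) {x} {y} = ≐-≤ (mk≐ px≐) (mk≐ y≐)
    where
    px≐ : p * ⟦ x ⟧ * ⟦ b ⟧ ≡ ⟦ a ℕ.* x ⟧
    px≐ = begin
      p * ⟦ x ⟧ * ⟦ b ⟧     ≡⟨ ℚP.*-assoc p ⟦ x ⟧ ⟦ b ⟧ ⟩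
      p * (⟦ x ⟧ * ⟦ b ⟧)   ≡⟨ cong (p *_) (ℚP.*-comm ⟦ x ⟧ ⟦ b ⟧) ⟩
      p * (⟦ b ⟧ * ⟦ x ⟧)   ≡⟨ ℚP.*-assoc p ⟦ b ⟧ ⟦ x ⟧ ⟨
      p * ⟦ b ⟧ * ⟦ x ⟧     ≡⟨ cong (_* ⟦ x ⟧) p≐ ⟩
      ⟦ a ⟧ * ⟦ x ⟧         ≡⟨ ⟦⟧-* a x ⟨
      ⟦ a ℕ.* x ⟧           ∎
      where open ≡-Reasoning
    y≐ : ⟦ y ⟧ * ⟦ b ⟧ ≡ ⟦ b ℕ.* y ⟧
    y≐ = trans (ℚP.*-comm ⟦ y ⟧ ⟦ b ⟧) (sym (⟦⟧-* b y))

  -- M = 1 + L + D stands for m = 1 + ℓ + d.  The inner denominator X = M² − L² − M + L of ratio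
  -- factors as (M − L)(M + L − 1), so (M − L)(1 + L²/X)(M + L − 1) = X + L² = L + M(M − 1).
  ratio-inner-denominator : ∀ {M} L D → M ≡ 1ℚ + (L + D) →
    M * M - L * L - M + L ≡ (1ℚ + D) * (L + (L + D))
  ratio-inner-denominator L D refl = solve 2 (λ L D → let M = con 1ℚ :+ (L :+ D) in
    M :* M :- L :* L :- M :+ L := (con 1ℚ :+ D) :* (L :+ (L :+ D))) refl L D
    where open ℚ-Solver using (solve; _:+_; _:*_; _:-_; _:=_; con)

  ratio-denominator : ∀ {M} L D u → M ≡ 1ℚ + (L + D) → u * (M * M - L * L - M + L) ≡ L * L →
    (M - L) * (1ℚ + u) * (L + (L + D)) ≡ L + M * (L + D)
  ratio-denominator L D u refl u*X≡L² = begin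
    (M - L) * (1ℚ + u) * (L + (L + D))  ≡⟨ solve 3 (λ L D u →
                                             let M = con 1ℚ :+ (L :+ D)
                                                 X = M :* M :- L :* L :- M :+ L
                                             in (M :- L) :* (con 1ℚ :+ u) :* (L :+ (L :+ D)) := X :+ u :* X)
                                             refl L D u ⟩
    X + u * X                           ≡⟨ cong (X +_) u*X≡L² ⟩
    X + L * L                           ≡⟨ solve 2 (λ L D →
                                             let M = con 1ℚ :+ (L :+ D)
                                             in M :* M :- L :* L :- M :+ L :+ L :* L := L :+ M :* (L :+ D))
                                             refl L D ⟩
    L + M * (L + D)                     ∎
    where
    open ≡-Reasoning
    open ℚ-Solver using (solve; _:+_; _:*_; _:-_; _:=_; con)
    M = 1ℚ + (L + D)
    X = M * M - L * L - M + L

  ratio≐ : ∀ {m ℓ} → 1 ≤ ℓ → ℓ ≤ m → ratio (suc m) ℓ ≐ ℓ ℕ.+ m / (ℓ ℕ.+ suc m ℕ.* m)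
  ratio≐ {m} {ℓ@(suc _)} _ ℓ≤m with d , refl ← ℕP.m≤n⇒∃[o]m+o≡n ℓ≤m =
    1⊘-≐ {(M - L) * (1ℚ + u)} (ℓ ℕ.+ m) (ℓ ℕ.+ suc m ℕ.* m) (begin
      (M - L) * (1ℚ + u) * ⟦ ℓ ℕ.+ m ⟧     ≡⟨ cong ((M - L) * (1ℚ + u) *_) K≡ ⟩
      (M - L) * (1ℚ + u) * (L + (L + D))   ≡⟨ ratio-denominator L D u M≡ u*X≡L² ⟩
      L + M * (L + D)                      ≡⟨ Q≡ ⟨
      ⟦ ℓ ℕ.+ suc m ℕ.* m ⟧                ∎)
    where
    open ≡-Reasoning
    L = ⟦ ℓ ⟧
    D = ⟦ d ⟧
    M = ⟦ suc m ⟧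
    X = M * M - L * L - M + L
    u = (L * L) ⊘ X
    M≡ : M ≡ 1ℚ + (L + D)
    M≡ = trans (⟦⟧-+ 1 m) (cong (1ℚ +_) (⟦⟧-+ ℓ d))
    K≡ : ⟦ ℓ ℕ.+ m ⟧ ≡ L + (L + D)
    K≡ = trans (⟦⟧-+ ℓ m) (cong (L +_) (⟦⟧-+ ℓ d))
    Q≡ : ⟦ ℓ ℕ.+ suc m ℕ.* m ⟧ ≡ L + M * (L + D)
    Q≡ = trans (⟦⟧-+ ℓ (suc m ℕ.* m)) (cong (L +_) (trans (⟦⟧-* (suc m) m) (cong (M *_) (⟦⟧-+ ℓ d))))
    X≡ : X ≡ ⟦ suc d ℕ.* (ℓ ℕ.+ m) ⟧
    X≡ = trans (ratio-inner-denominator L D M≡) (sym (trans (⟦⟧-* (suc d) (ℓ ℕ.+ m)) (cong₂ _*_ (⟦⟧-+ 1 d) K≡)))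
    u*X≡L² : u * X ≡ L * L
    u*X≡L² = ⊘-*-cancelʳ (L * L) (subst (_≢ 0ℚ) (sym X≡) (⟦⟧≢0 (suc d ℕ.* (ℓ ℕ.+ m))))

  lowerBound≐ : ∀ {m ℓ z} .{{_ : NonZero z}} → ℓ ℕ.+ z ≡ m ℕ.+ m → lowerBound m ℓ ≐ 2 / z
  lowerBound≐ {m} {ℓ} {z} ℓ+z≡m+m = 1⊘-≐ {M - L ⊘ ⟦ 2 ⟧} 2 z (begin
    (M - L ⊘ ⟦ 2 ⟧) * ⟦ 2 ⟧     ≡⟨ solve 2 (λ M h → (M :- h) :* con ⟦ 2 ⟧ := M :+ M :- h :* con ⟦ 2 ⟧)
                                     refl M (L ⊘ ⟦ 2 ⟧) ⟩
    M + M - L ⊘ ⟦ 2 ⟧ * ⟦ 2 ⟧   ≡⟨ cong (λ x → M + M - x) (⊘-*-cancelʳ L (⟦⟧≢0 2)) ⟩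
    M + M - L                   ≡⟨ cong (_- L) L+Z≡M+M ⟨
    L + Z - L                   ≡⟨ solve 2 (λ L Z → L :+ Z :- L := Z) refl L Z ⟩
    Z                           ∎)
    where
    open ≡-Reasoning
    open ℚ-Solver using (solve; _:+_; _:*_; _:-_; _:=_; con)
    L = ⟦ ℓ ⟧
    M = ⟦ m ⟧
    Z = ⟦ z ⟧
    L+Z≡M+M : L + Z ≡ M + M
    L+Z≡M+M = trans (sym (⟦⟧-+ ℓ z)) (trans (cong ⟦_⟧ ℓ+z≡m+m) (⟦⟧-+ m m))

  lowerBound≤ratio : ∀ {m ℓ} → 1 ≤ ℓ → ℓ < m → lowerBound m ℓ ℚ.≤ ratio m ℓ
  lowerBound≤ratio {ℓ = ℓ@(suc _)} 1≤ℓ ℓ<m with d , refl ← ℕP.m≤n⇒∃[o]m+o≡n ℓ<m =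
    ≐-≤-cross (lowerBound≐ {m} {ℓ} {z} ℓ+z≡m+m) (ratio≐ 1≤ℓ (ℕP.m≤m+n ℓ d)) (begin
      2 ℕ.* Q               ≤⟨ ℕP.m≤m+n (2 ℕ.* Q) (d ℕ.* ℓ) ⟩
      2 ℕ.* Q ℕ.+ d ℕ.* ℓ   ≡⟨ solve 2 (λ ℓ d →
                                 con 2 :* (ℓ :+ (con 1 :+ (ℓ :+ d)) :* (ℓ :+ d)) :+ d :* ℓ
                                 := (ℓ :+ (ℓ :+ d)) :* ((con 1 :+ (ℓ :+ d)) :+ (con 1 :+ d)))
                                 refl ℓ d ⟩
      K ℕ.* z               ∎)
    where
    open ℕP.≤-Reasoning
    open ℕ-Solver using (solve; _:+_; _:*_; _:=_; con)
    m = suc (ℓ ℕ.+ d)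
    K = ℓ ℕ.+ (ℓ ℕ.+ d)
    Q = ℓ ℕ.+ m ℕ.* (ℓ ℕ.+ d)
    z = m ℕ.+ suc d
    ℓ+z≡m+m : ℓ ℕ.+ z ≡ m ℕ.+ m
    ℓ+z≡m+m = solve 2 (λ ℓ d → let m = con 1 :+ (ℓ :+ d) in ℓ :+ (m :+ (con 1 :+ d)) := m :+ m) refl ℓ d

open Data.Nat using (_+_; _*_; _⊓_)

𝟙 : ∀ {a} {A : Set a} → Dec A → ℕ
𝟙 a? = if does a? then 1 else 0

𝟙-yes : ∀ {a} {A : Set a} (a? : Dec A) → A → 𝟙 a? ≡ 1
𝟙-yes (yes _) _ = refl
𝟙-yes (no ¬a) a = contradiction a ¬a

𝟙-no : ∀ {a} {A : Set a} (a? : Dec A) → ¬ A → 𝟙 a? ≡ 0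
𝟙-no (yes a) ¬a = contradiction a ¬a
𝟙-no (no _)  _  = refl

𝟙≤1 : ∀ {a} {A : Set a} (a? : Dec A) → 𝟙 a? ≤ 1
𝟙≤1 (yes _) = ℕP.≤-refl
𝟙≤1 (no _)  = z≤n

𝟙-mono : ∀ {a b} {A : Set a} {B : Set b} (a? : Dec A) (b? : Dec B) → (A → B) → 𝟙 a? ≤ 𝟙 b?
𝟙-mono (yes a) b? a⇒b = ℕP.≤-reflexive (sym (𝟙-yes b? (a⇒b a)))
𝟙-mono (no _)  _  _   = z≤n

𝟙-either : ∀ {a b} {A : Set a} {B : Set b} (a? : Dec A) (b? : Dec B) → (¬ B → A) → 1 ≤ 𝟙 a? + 𝟙 b?
𝟙-either (yes _) _       _    = s≤s z≤n
𝟙-either (no _)  (yes _) _    = ℕP.≤-refl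
𝟙-either (no ¬a) (no ¬b) ¬b⇒a = contradiction (¬b⇒a ¬b) ¬a

𝟙-exclusive : ∀ {a b} {A : Set a} {B : Set b} (a? : Dec A) (b? : Dec B) → (A → ¬ B) → 𝟙 a? + 𝟙 b? ≤ 1
𝟙-exclusive (yes a) (yes b) a⇒¬b = contradiction b (a⇒¬b a)
𝟙-exclusive (yes _) (no _)  _    = ℕP.≤-refl
𝟙-exclusive (no _)  b?      _    = 𝟙≤1 b?

sum-const : ∀ k x → sum {k} (λ _ → x) ≡ k * x
sum-const zero    x = refl
sum-const (suc k) x = cong (x +_) (sum-const k x)

sum-mono-≤ : ∀ {k} {f g : Fin k → ℕ} → (∀ i → f i ≤ g i) → sum f ≤ sum g
sum-mono-≤ {zero}  f≤g = z≤n
sum-mono-≤ {suc k} f≤g = ℕP.+-mono-≤ (f≤g F.zero) (sum-mono-≤ (λ i → f≤g (F.suc i)))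

sum-≤1 : ∀ {k} {f : Fin k → ℕ} → (∀ i → f i ≤ 1) → sum f ≤ k
sum-≤1 {k} {f} f≤1 = begin
  sum f               ≤⟨ sum-mono-≤ f≤1 ⟩
  sum {k} (λ _ → 1)   ≡⟨ sum-const k 1 ⟩
  k * 1               ≡⟨ ℕP.*-identityʳ k ⟩
  k                   ∎
  where open ℕP.≤-Reasoning

length-filter-tabulate : ∀ {a p} {A : Set a} {P : A → Set p} (P? : Decidable P) {k} (f : Fin k → A) →
  length (filter P? (tabulate f)) ≡ sum (λ i → 𝟙 (P? (f i)))
length-filter-tabulate P? {zero}  f = refl
length-filter-tabulate P? {suc k} f with does (P? (f F.zero))
... | true  = cong suc (length-filter-tabulate P? (λ i → f (F.suc i)))
... | false = length-filter-tabulate P? (λ i → f (F.suc i))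

count-< : ∀ k t → sum {k} (λ q → 𝟙 (toℕ q ℕP.<? t)) ≡ t ⊓ k
count-< zero    t       = sym (ℕP.⊓-zeroʳ t)
count-< (suc k) zero    = count-< k zero
count-< (suc k) (suc t) = cong suc (count-< k t)

module _ {m : ℕ} where

  ahead : Ballot m → Fin m → Fin m → ℕ
  ahead π c d = 𝟙 (pos π c F.<? pos π d)

  first : Ballot m → Fin m → ℕ
  first π c = 𝟙 (toℕ (pos π c) ℕP.<? 1)

  ahead-irrefl : ∀ (π : Ballot m) c → ahead π c c ≡ 0
  ahead-irrefl π c = 𝟙-no (pos π c F.<? pos π c) (ℕP.<-irrefl refl)

  ahead-exclusive : ∀ (π : Ballot m) c d → ahead π c d + ahead π d c ≤ 1
  ahead-exclusive π c d = 𝟙-exclusive (pos π c F.<? pos π d) (pos π d F.<? pos π c) ℕP.<-asym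

  pos-injective : ∀ (π : Ballot m) {c d} → pos π c ≡ pos π d → c ≡ d
  pos-injective π {c} {d} eq = begin
    c                  ≡⟨ inverseʳ π ⟨
    π ⟨$⟩ʳ (pos π c)   ≡⟨ cong (π ⟨$⟩ʳ_) eq ⟩
    π ⟨$⟩ʳ (pos π d)   ≡⟨ inverseʳ π ⟩
    d                  ∎
    where open ≡-Reasoning

  count-ranked-< : ∀ (π : Ballot m) t → sum (λ c → 𝟙 (toℕ (pos π c) ℕP.<? t)) ≡ t ⊓ m
  count-ranked-< π t = begin
    sum (λ c → 𝟙 (toℕ (pos π c) ℕP.<? t))            ≡⟨ sum-permute (λ c → 𝟙 (toℕ (pos π c) ℕP.<? t)) π ⟩
    sum (λ q → 𝟙 (toℕ (pos π (π ⟨$⟩ʳ q)) ℕP.<? t))   ≡⟨ sum-cong-≗ (λ q → cong (λ p → 𝟙 (toℕ p ℕP.<? t))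
                                                                                 (inverseˡ π {q})) ⟩
    sum {m} (λ q → 𝟙 (toℕ q ℕP.<? t))                 ≡⟨ count-< m t ⟩
    t ⊓ m                                             ∎
    where open ≡-Reasoning

  sum-ahead : ∀ (π : Ballot m) c → sum (λ d → ahead π d c) ≡ toℕ (pos π c)
  sum-ahead π c = trans (count-ranked-< π (toℕ (pos π c))) (ℕP.m≤n⇒m⊓n≡m (ℕP.<⇒≤ (FP.toℕ<n (pos π c))))

  first-ahead : ∀ (π : Ballot m) {c d} → toℕ (pos π c) < 1 → d ≢ c → pos π c F.< pos π d
  first-ahead π {c} {d} c<1 d≢c = ℕP.<-≤-trans c<1 (ℕP.n≢0⇒n>0 d-not-first)
    where
    d-not-first : toℕ (pos π d) ≢ 0
    d-not-first d≡0 = d≢c (pos-injective π (FP.toℕ-injective (trans d≡0 (sym (ℕP.n<1⇒n≡0 c<1)))))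

  record AgreeOnTop (ℓ : ℕ) (π π′ : Ballot m) : Set where
    constructor agreeOnTop
    field
      ⟨$⟩ʳ-agree : ∀ p → toℕ p < ℓ → π′ ⟨$⟩ʳ p ≡ π ⟨$⟩ʳ p

  AgreeOnTop-sym : ∀ {ℓ π π′} → AgreeOnTop ℓ π π′ → AgreeOnTop ℓ π′ π
  AgreeOnTop-sym (agreeOnTop agree) = agreeOnTop (λ p p<ℓ → sym (agree p p<ℓ))

  pos-agreeOnTop : ∀ {ℓ π π′} → AgreeOnTop ℓ π π′ → ∀ c → toℕ (pos π c) < ℓ → pos π′ c ≡ pos π c
  pos-agreeOnTop {π = π} {π′} (agreeOnTop agree) c c<ℓ = begin
    π′ ⟨$⟩ˡ c                     ≡⟨ cong (π′ ⟨$⟩ˡ_) (trans (agree (pos π c) c<ℓ) (inverseʳ π)) ⟨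
    π′ ⟨$⟩ˡ (π′ ⟨$⟩ʳ (pos π c))   ≡⟨ inverseˡ π′ ⟩
    pos π c                       ∎
    where open ≡-Reasoning

  ahead-agreeOnTop : ∀ {ℓ π π′} → AgreeOnTop ℓ π π′ → ∀ {c d} → toℕ (pos π c) < ℓ →
    pos π c F.< pos π d → pos π′ c F.< pos π′ d
  ahead-agreeOnTop {ℓ} {π} {π′} agree {c} {d} c<ℓ c<d =
    subst (λ p → toℕ p < toℕ (pos π′ d)) (sym (pos-agreeOnTop agree c c<ℓ)) (c-ahead (toℕ (pos π′ d) ℕP.<? ℓ))
    where
    c-ahead : Dec (toℕ (pos π′ d) < ℓ) → toℕ (pos π c) < toℕ (pos π′ d)
    c-ahead (yes d<ℓ) = subst (λ p → toℕ (pos π c) < toℕ p) (pos-agreeOnTop (AgreeOnTop-sym agree) d d<ℓ) c<d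
    c-ahead (no d≮ℓ)  = ℕP.<-≤-trans c<ℓ (ℕP.≮⇒≥ d≮ℓ)

  ahead-or-behind : ∀ {ℓ πB πW} → AgreeOnTop ℓ πB πW → ∀ {c d} → d ≢ c →
    toℕ (pos πB c) < ℓ → 1 ≤ ahead πW c d + ahead πB d c
  ahead-or-behind {πB = πB} {πW} agree {c} {d} d≢c c<ℓ =
    𝟙-either (pos πW c F.<? pos πW d) (pos πB d F.<? pos πB c) λ d≮c →
      ahead-agreeOnTop agree c<ℓ (ℕP.≤∧≢⇒< (ℕP.≮⇒≥ d≮c) λ eq →
        d≢c (pos-injective πB (FP.toℕ-injective (sym eq))))

  voter-bound : ∀ {ℓ πB πW} → AgreeOnTop ℓ πB πW → ∀ {c d} → d ≢ c →
    ℓ ≤ ℓ * ahead πW c d + ℓ * ahead πB d c + toℕ (pos πB c)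
  voter-bound {ℓ} {πB} {πW} agree {c} {d} d≢c with toℕ (pos πB c) ℕP.<? ℓ
  ... | no c≮ℓ  = ℕP.≤-trans (ℕP.≮⇒≥ c≮ℓ) (ℕP.m≤n+m _ _)
  ... | yes c<ℓ = ℕP.≤-trans (begin
    ℓ                                     ≡⟨ ℕP.*-identityʳ ℓ ⟨
    ℓ * 1                                 ≤⟨ ℕP.*-monoʳ-≤ ℓ (ahead-or-behind agree d≢c c<ℓ) ⟩
    ℓ * (ahead πW c d + ahead πB d c)     ≡⟨ ℕP.*-distribˡ-+ ℓ (ahead πW c d) (ahead πB d c) ⟩
    ℓ * ahead πW c d + ℓ * ahead πB d c   ∎) (ℕP.m≤m+n _ _)
    where open ℕP.≤-Reasoning

sum-first : ∀ {m} (π : Ballot (suc m)) → sum (first π) ≡ 1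
sum-first π = count-ranked-< π 1

⊓-≤-either : ∀ {v} x y → x ≤ v ⊎ y ≤ v → x ⊓ y ≤ v
⊓-≤-either x y = [ ℕP.m≤n⇒m⊓o≤n y , ℕP.m≤n⇒o⊓m≤n x ]′

⊓-preserves : ∀ {p} (P : ℕ → Set p) {x y} → P x → P y → P (x ⊓ y)
⊓-preserves P {x} {y} Px Py = [ (λ eq → subst P (sym eq) Px) , (λ eq → subst P (sym eq) Py) ]′ (ℕP.⊓-sel x y)

rivals : ∀ {m} → Fin m → List (Fin m)
rivals {m} c = filter (λ d → ¬? (d FP.≟ c)) (allFin m)

module _ {n m : ℕ} (E : Election n m) where

  scPair≡sum-ahead : ∀ c d → scPair E c d ≡ sum (λ i → ahead (E i) c d)
  scPair≡sum-ahead c d = length-filter-tabulate (λ i → pos (E i) c F.<? pos (E i) d) (λ i → i)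

  scPair-irrefl : ∀ c → scPair E c c ≡ 0
  scPair-irrefl c = begin
    scPair E c c                  ≡⟨ scPair≡sum-ahead c c ⟩
    sum (λ i → ahead (E i) c c)   ≡⟨ sum-cong-≗ (λ i → ahead-irrefl (E i) c) ⟩
    sum {n} (λ _ → 0)             ≡⟨ sum-const n 0 ⟩
    n * 0                         ≡⟨ ℕP.*-zeroʳ n ⟩
    0                             ∎
    where open ≡-Reasoning

  scPair+scPair≤n : ∀ c d → scPair E c d + scPair E d c ≤ n
  scPair+scPair≤n c d = begin
    scPair E c d + scPair E d c                                 ≡⟨ cong₂ _+_ (scPair≡sum-ahead c d)
                                                                             (scPair≡sum-ahead d c) ⟩
    sum (λ i → ahead (E i) c d) + sum (λ i → ahead (E i) d c)   ≡⟨ ∑-distrib-+ (λ i → ahead (E i) c d)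
                                                                               (λ i → ahead (E i) d c) ⟨
    sum (λ i → ahead (E i) c d + ahead (E i) d c)               ≤⟨ sum-≤1 (λ i → ahead-exclusive (E i) c d) ⟩
    n                                                           ∎
    where open ℕP.≤-Reasoning

  scMM≤n : ∀ c → scMM E c ≤ n
  scMM≤n c = foldr-preservesᵒ {P = _≤ n} ⊓-≤-either n (map (scPair E c) (rivals c)) (inj₁ ℕP.≤-refl)

  scMM≤scPair : ∀ {c d} → d ≢ c → scMM E c ≤ scPair E c d
  scMM≤scPair {c} {d} d≢c = foldr-preservesᵒ {P = _≤ scPair E c d} ⊓-≤-either n (map (scPair E c) (rivals c))
    (inj₂ (Any.map⁺ (Any.map (λ { refl → ℕP.≤-refl }) (∈-filter⁺ (λ d → ¬? (d FP.≟ c)) (∈-allFin d) d≢c))))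

  scMM-elim : ∀ {p} (P : ℕ → Set p) {c} → P n → (∀ d → d ≢ c → P (scPair E c d)) → P (scMM E c)
  scMM-elim P {c} Pn Pd = foldr-preservesᵇ {P = P} (⊓-preserves P) Pn
    (All.map⁺ (All.tabulate λ {d} d∈ → Pd d (proj₂ (∈-filter⁻ (λ d → ¬? (d FP.≟ c)) {xs = allFin m} d∈))))

  scPair+scMM≤n : ∀ {c d} → d ≢ c → scPair E d c + scMM E c ≤ n
  scPair+scMM≤n {c} {d} d≢c = ℕP.≤-trans (ℕP.+-monoʳ-≤ (scPair E d c) (scMM≤scPair d≢c)) (scPair+scPair≤n d c)

  sum-pos≡sum-defeats : ∀ c → sum (λ i → toℕ (pos (E i) c)) ≡ sum (λ d → scPair E d c)
  sum-pos≡sum-defeats c = begin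
    sum (λ i → toℕ (pos (E i) c))             ≡⟨ sum-cong-≗ (λ i → sum-ahead (E i) c) ⟨
    sum (λ i → sum (λ d → ahead (E i) d c))   ≡⟨ ∑-comm (λ i d → ahead (E i) d c) ⟩
    sum (λ d → sum (λ i → ahead (E i) d c))   ≡⟨ sum-cong-≗ (λ d → scPair≡sum-ahead d c) ⟨
    sum (λ d → scPair E d c)                  ∎
    where open ≡-Reasoning

sum-defeats-bound : ∀ {n m} (E : Election n (suc m)) c → sum (λ d → scPair E d c) + m * scMM E c ≤ m * n
sum-defeats-bound {n} {m} E c = begin
  sum t + m * B                                    ≡⟨ cong (_+ m * B) (sum-remove {i = c} t) ⟩
  t c + sum (λ j → t (punchIn c j)) + m * B        ≡⟨ cong (λ x → x + sum (λ j → t (punchIn c j)) + m * B)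
                                                           (scPair-irrefl E c) ⟩
  sum (λ j → t (punchIn c j)) + m * B              ≡⟨ cong (sum (λ j → t (punchIn c j)) +_) (sum-const m B) ⟨
  sum (λ j → t (punchIn c j)) + sum {m} (λ _ → B)  ≡⟨ ∑-distrib-+ (λ j → t (punchIn c j)) (λ _ → B) ⟨
  sum (λ j → t (punchIn c j) + B)                  ≤⟨ sum-mono-≤ (λ j → scPair+scMM≤n E (FP.punchInᵢ≢i c j)) ⟩
  sum {m} (λ _ → n)                                ≡⟨ sum-const m n ⟩
  m * n                                            ∎
  where
  open ℕP.≤-Reasoning
  t : Fin (suc m) → ℕ
  t d = scPair E d c
  B = scMM E c

firsts : ∀ {n m} → Election n m → Fin m → ℕ
firsts E c = sum (λ i → first (E i) c)

sum-firsts : ∀ {n m} (E : Election n (suc m)) → sum (firsts E) ≡ n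
sum-firsts {n} E = begin
  sum (firsts E)                          ≡⟨ ∑-comm (λ c i → first (E i) c) ⟩
  sum (λ i → sum (first (E i)))           ≡⟨ sum-cong-≗ (λ i → sum-first (E i)) ⟩
  sum {n} (λ _ → 1)                       ≡⟨ sum-const n 1 ⟩
  n * 1                                   ≡⟨ ℕP.*-identityʳ n ⟩
  n                                       ∎
  where open ≡-Reasoning

module _ {n m ℓ : ℕ} {E : Election n m} where

  completions-agreeOnTop : ∀ {E₁ E₂} → IsCompletion ℓ E E₁ → IsCompletion ℓ E E₂ →
    ∀ i → AgreeOnTop ℓ (E₁ i) (E₂ i)
  completions-agreeOnTop E₁-comp E₂-comp i =
    agreeOnTop (λ p p<ℓ → trans (E₂-comp i p p<ℓ) (sym (E₁-comp i p p<ℓ)))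

  firsts≤scMM : 1 ≤ ℓ → ∀ {E′} → IsCompletion ℓ E E′ → ∀ c → firsts E c ≤ scMM E′ c
  firsts≤scMM 1≤ℓ {E′} E′-comp c =
    scMM-elim E′ (firsts E c ≤_) (sum-≤1 (λ i → 𝟙≤1 (toℕ (pos (E i) c) ℕP.<? 1))) λ d d≢c →
      subst (firsts E c ≤_) (sym (scPair≡sum-ahead E′ c d)) (sum-mono-≤ (λ i →
        𝟙-mono (toℕ (pos (E i) c) ℕP.<? 1) (pos (E′ i) c F.<? pos (E′ i) d) λ c<1 →
          ahead-agreeOnTop {π = E i} {E′ i} (agreeOnTop (E′-comp i)) (ℕP.<-≤-trans c<1 1≤ℓ)
            (first-ahead (E i) c<1 d≢c)))

  firsts≤worst : 1 ≤ ℓ → ∀ {c w} → IsWorst ℓ E c w → firsts E c ≤ w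
  firsts≤worst 1≤ℓ {c} ((E′ , E′-comp , scMM≡w) , _) =
    subst (firsts E c ≤_) scMM≡w (firsts≤scMM 1≤ℓ {E′} E′-comp c)

  sum-voter-bound : ∀ {EB EW} → IsCompletion ℓ E EB → IsCompletion ℓ E EW → ∀ {c d} → d ≢ c →
    ℓ * n ≤ ℓ * scPair EW c d + ℓ * scPair EB d c + sum (λ d′ → scPair EB d′ c)
  sum-voter-bound {EB} {EW} EB-comp EW-comp {c} {d} d≢c = begin
    ℓ * n                                 ≡⟨ trans (ℕP.*-comm ℓ n) (sym (sum-const n ℓ)) ⟩
    sum {n} (λ _ → ℓ)                     ≤⟨ sum-mono-≤ (λ i → voter-bound (agree i) d≢c) ⟩
    sum (λ i → ℓ * w i + ℓ * b i + p i)   ≡⟨ split ⟩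
    ℓ * scPair EW c d + ℓ * scPair EB d c + sum (λ d′ → scPair EB d′ c) ∎
    where
    open ℕP.≤-Reasoning
    agree : ∀ i → AgreeOnTop ℓ (EB i) (EW i)
    agree = completions-agreeOnTop {EB} {EW} EB-comp EW-comp
    w b p : Fin n → ℕ
    w i = ahead (EW i) c d
    b i = ahead (EB i) d c
    p i = toℕ (pos (EB i) c)
    split : sum (λ i → ℓ * w i + ℓ * b i + p i) ≡
            ℓ * scPair EW c d + ℓ * scPair EB d c + sum (λ d′ → scPair EB d′ c)
    split = begin-equality
      sum (λ i → ℓ * w i + ℓ * b i + p i)
        ≡⟨ ∑-distrib-+ (λ i → ℓ * w i + ℓ * b i) p ⟩
      sum (λ i → ℓ * w i + ℓ * b i) + sum p
        ≡⟨ cong (_+ sum p) (∑-distrib-+ (λ i → ℓ * w i) (λ i → ℓ * b i)) ⟩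
      sum (λ i → ℓ * w i) + sum (λ i → ℓ * b i) + sum p
        ≡⟨ cong₂ (λ x y → x + y + sum p) (*-distribˡ-sum ℓ w) (*-distribˡ-sum ℓ b) ⟨
      ℓ * sum w + ℓ * sum b + sum p
        ≡⟨ cong₂ (λ x y → ℓ * x + ℓ * y + sum p) (scPair≡sum-ahead EW c d) (scPair≡sum-ahead EB d c) ⟨
      ℓ * scPair EW c d + ℓ * scPair EB d c + sum p
        ≡⟨ cong (ℓ * scPair EW c d + ℓ * scPair EB d c +_) (sum-pos≡sum-defeats EB c) ⟩
      ℓ * scPair EW c d + ℓ * scPair EB d c + sum (λ d′ → scPair EB d′ c) ∎

n≤m*worst : ∀ {n m ℓ} {E : Election n (suc m)} {worst : Fin (suc m) → ℕ} {a} → 1 ≤ ℓ →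
  (∀ c → IsWorst ℓ E c (worst c)) → (∀ c → worst c ≤ worst a) → n ≤ suc m * worst a
n≤m*worst {n} {m} {E = E} {worst} {a} 1≤ℓ isWorst a-max = begin
  n                             ≡⟨ sum-firsts E ⟨
  sum (firsts E)                ≤⟨ sum-mono-≤ (λ c → ℕP.≤-trans (firsts≤worst {E = E} 1≤ℓ {c} (isWorst c))
                                                                (a-max c)) ⟩
  sum {suc m} (λ _ → worst a)   ≡⟨ sum-const (suc m) (worst a) ⟩
  suc m * worst a               ∎
  where open ℕP.≤-Reasoning

scMM-completions-tradeoff : ∀ {n m ℓ} {E EB EW : Election n (suc m)} →
  IsCompletion ℓ E EB → IsCompletion ℓ E EW →
  ∀ c → ℓ * n + (ℓ + m) * scMM EB c ≤ ℓ * scMM EW c + (ℓ + m) * n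
scMM-completions-tradeoff {n} {m} {ℓ} {E} {EB} {EW} EB-comp EW-comp c =
  scMM-elim EW (λ w → ℓ * n + (ℓ + m) * B ≤ ℓ * w + (ℓ + m) * n)
    (ℕP.+-monoʳ-≤ (ℓ * n) (ℕP.*-monoʳ-≤ (ℓ + m) (scMM≤n EB c)))
    λ d d≢c → combine (sum-voter-bound {E = E} {EB} {EW} EB-comp EW-comp d≢c) (sum-defeats-bound EB c)
                (subst (_≤ n) (ℕP.+-comm (scPair EB d c) B) (scPair+scMM≤n EB d≢c))
  where
  B = scMM EB c
  combine : ∀ {W x S} → ℓ * n ≤ ℓ * W + ℓ * x + S → S + m * B ≤ m * n → B + x ≤ n →
    ℓ * n + (ℓ + m) * B ≤ ℓ * W + (ℓ + m) * n
  combine {W} {x} {S} h₁ h₂ h₃ = begin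
    ℓ * n + (ℓ + m) * B                 ≡⟨ solve 4 (λ ℓ m n B → ℓ :* n :+ (ℓ :+ m) :* B
                                                             := ℓ :* n :+ m :* B :+ ℓ :* B) refl ℓ m n B ⟩
    ℓ * n + m * B + ℓ * B               ≤⟨ ℕP.+-monoˡ-≤ (ℓ * B) (ℕP.+-monoˡ-≤ (m * B) h₁) ⟩
    ℓ * W + ℓ * x + S + m * B + ℓ * B   ≡⟨ solve 6 (λ ℓ m B W x S → ℓ :* W :+ ℓ :* x :+ S :+ m :* B :+ ℓ :* B
                                                             := ℓ :* W :+ (S :+ m :* B) :+ ℓ :* (B :+ x))
                                                   refl ℓ m B W x S ⟩
    ℓ * W + (S + m * B) + ℓ * (B + x)   ≤⟨ ℕP.+-mono-≤ (ℕP.+-monoʳ-≤ (ℓ * W) h₂) (ℕP.*-monoʳ-≤ ℓ h₃) ⟩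
    ℓ * W + m * n + ℓ * n               ≡⟨ solve 4 (λ ℓ m n W → ℓ :* W :+ m :* n :+ ℓ :* n
                                                             := ℓ :* W :+ (ℓ :+ m) :* n) refl ℓ m n W ⟩
    ℓ * W + (ℓ + m) * n                 ∎
    where
    open ℕP.≤-Reasoning
    open ℕ-Solver using (solve; _:+_; _:*_; _:=_; con)

best-bounded-by-worst : ∀ {n m ℓ} {E : Election n (suc m)} {worst : Fin (suc m) → ℕ} {a b β} → 1 ≤ ℓ →
  (∀ c → IsWorst ℓ E c (worst c)) → (∀ c → worst c ≤ worst a) → IsBest ℓ E b β →
  (ℓ + m) * β ≤ (ℓ + suc m * m) * worst a
best-bounded-by-worst {n} {m} {ℓ} {E} {worst} {a} {b} 1≤ℓ isWorst a-max ((EB , EB-comp , refl) , _)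
  with isWorst b
... | (EW , EW-comp , scMM≡worst) , _ = begin
  (ℓ + m) * scMM EB b           ≤⟨ ℕP.+-cancelˡ-≤ (ℓ * n) _ _ (ℕP.≤-trans tradeoff (ℕP.≤-reflexive regroup)) ⟩
  ℓ * worst b + m * n           ≤⟨ ℕP.+-mono-≤ (ℕP.*-monoʳ-≤ ℓ (a-max b))
                                               (ℕP.*-monoʳ-≤ m (n≤m*worst {E = E} 1≤ℓ isWorst a-max)) ⟩
  ℓ * W + m * (suc m * W)       ≡⟨ solve 3 (λ ℓ m W → ℓ :* W :+ m :* ((con 1 :+ m) :* W)
                                                   := (ℓ :+ (con 1 :+ m) :* m) :* W) refl ℓ m W ⟩
  (ℓ + suc m * m) * W           ∎
  where
  open ℕP.≤-Reasoning
  open ℕ-Solver using (solve; _:+_; _:*_; _:=_; con)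
  W = worst a
  tradeoff : ℓ * n + (ℓ + m) * scMM EB b ≤ ℓ * worst b + (ℓ + m) * n
  tradeoff = subst (λ w → ℓ * n + (ℓ + m) * scMM EB b ≤ ℓ * w + (ℓ + m) * n) scMM≡worst
    (scMM-completions-tradeoff {E = E} {EB} {EW} EB-comp EW-comp b)
  regroup : ℓ * worst b + (ℓ + m) * n ≡ ℓ * n + (ℓ * worst b + m * n)
  regroup = solve 4 (λ ℓ m n w → ℓ :* w :+ (ℓ :+ m) :* n := ℓ :* n :+ (ℓ :* w :+ m :* n)) refl ℓ m n (worst b)

output-approximates : ∀ {m} {K Q : ℕ} .{{_ : NonZero Q}} → K ≤ Q →
  (score worst best : Fin m → ℕ) → (∀ c → worst c ≤ score c) → (∀ c → score c ≤ best c) →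
  ∀ a b₁ b₂ → (∀ b → K * best b ≤ Q * worst a) → (∀ c → c ≢ b₁ → best c ≤ best b₂) →
  ∀ c → K * score c ≤ Q * score (output worst best a b₁ b₂)
output-approximates {K = K} {Q} K≤Q score worst best worst≤score score≤best a b₁ b₂ best≤worst-a b₂-max c
  with worst b₁ * best b₁ ≤? worst a * best b₂
... | yes _ = begin
  K * score c   ≤⟨ ℕP.*-monoʳ-≤ K (score≤best c) ⟩
  K * best c    ≤⟨ best≤worst-a c ⟩
  Q * worst a   ≤⟨ ℕP.*-monoʳ-≤ Q (worst≤score a) ⟩
  Q * score a   ∎
  where open ℕP.≤-Reasoning
... | no ≰ with c FP.≟ b₁
...   | yes refl = ℕP.*-monoˡ-≤ (score c) K≤Q
...   | no c≢b₁  = begin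
  K * score c    ≤⟨ ℕP.*-monoʳ-≤ K (ℕP.≤-trans (score≤best c) (b₂-max c c≢b₁)) ⟩
  K * best b₂    ≤⟨ ℕP.<⇒≤ (ℕP.*-cancelˡ-< (best b₁) _ _ cross) ⟩
  Q * worst b₁   ≤⟨ ℕP.*-monoʳ-≤ Q (worst≤score b₁) ⟩
  Q * score b₁   ∎
  where
  open ℕP.≤-Reasoning
  open ℕ-Solver using (solve; _:+_; _:*_; _:=_; con)
  cross : best b₁ * (K * best b₂) < best b₁ * (Q * worst b₁)
  cross = begin-strict
    best b₁ * (K * best b₂)    ≡⟨ solve 3 (λ x y z → x :* (y :* z) := y :* x :* z) refl _ K _ ⟩
    K * best b₁ * best b₂      ≤⟨ ℕP.*-monoˡ-≤ (best b₂) (best≤worst-a b₁) ⟩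
    Q * worst a * best b₂      ≡⟨ ℕP.*-assoc Q (worst a) (best b₂) ⟩
    Q * (worst a * best b₂)    <⟨ ℕP.*-monoʳ-< Q (ℕP.≰⇒> ≰) ⟩
    Q * (worst b₁ * best b₁)   ≡⟨ solve 3 (λ x y z → x :* (y :* z) := z :* (x :* y)) refl Q (worst b₁) _ ⟩
    best b₁ * (Q * worst b₁)   ∎

theorem5 : ∀ {n m ℓ : ℕ} → 1 ≤ ℓ → ℓ < m →
    (E : Election n m) →
    (worst best : Fin m → ℕ) →
    (∀ c → IsWorst ℓ E c (worst c)) →
    (∀ c → IsBest ℓ E c (best c)) →
    (a b₁ b₂ : Fin m) →
    (∀ c → worst c ≤ worst a) →
    (∀ c → best c ≤ best b₁) →
    b₂ ≢ b₁ →
    (∀ c → c ≢ b₁ → best c ≤ best b₂) →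
    (∀ c → ratio m ℓ ℚ.* ⟦ scMM E c ⟧ ℚ.≤ ⟦ scMM E (output worst best a b₁ b₂) ⟧)
    × (lowerBound m ℓ ℚ.≤ ratio m ℓ)
theorem5 {ℓ = zero} ()
theorem5 {m = zero} _ ()
theorem5 {m = suc m} {ℓ@(suc _)} 1≤ℓ ℓ<m@(s≤s ℓ≤m) E worst best isWorst isBest a b₁ b₂ a-max _ _ b₂-max =
  (λ c → ≐-*-≤ (ratio≐ 1≤ℓ ℓ≤m) (output-approximates K≤Q (scMM E) worst best worst≤scMM scMM≤best a b₁ b₂
                                   best≤worst-a b₂-max c))
  , lowerBound≤ratio 1≤ℓ ℓ<m
  where
  E-completes-itself : IsCompletion ℓ E E
  E-completes-itself _ _ _ = refl
  worst≤scMM : ∀ c → worst c ≤ scMM E c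
  worst≤scMM c = proj₂ (isWorst c) E E-completes-itself
  scMM≤best : ∀ c → scMM E c ≤ best c
  scMM≤best c = proj₂ (isBest c) E E-completes-itself
  best≤worst-a : ∀ b → (ℓ + m) * best b ≤ (ℓ + suc m * m) * worst a
  best≤worst-a b = best-bounded-by-worst {E = E} {b = b} 1≤ℓ isWorst a-max (isBest b)
  K≤Q : ℓ + m ≤ ℓ + suc m * m
  K≤Q = ℕP.+-monoʳ-≤ ℓ (ℕP.m≤m+n m (m * m))
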